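{- Let $G$ be a 2-connected graph with a normal spanning tree $T$, and suppose the vertices of $G$ are numbered with a numbering compatible with $T$. Let $(A,B)$ be a half-connected type-1 separation of $G$ and $(A',B')$ any type-1 separation of $G$. Then $(A,B)$ and $(A',B')$ are nested.
   Context: A separation of $G$ is a pair $(A,B)$ with $A\cup B=V(G)$, $A\setminus B,B\setminus A\neq\emptyset$, no edge between them; $(A,B)=(B,A)$; 2-separations have $|A\cap B|=2$. $(A,B),(C,D)$ are nested if after possibly swapping $A,B$ and swapping $C,D$, $A\subseteq C$ and $D\subseteq B$. Half-connected: $G[A\setminus B]$ or $G[B\setminus A]$ connected. $T$ rooted at $r$; $T(u,v)$ is the $u$–$v$ path in $T$ without $u,v$; $ND(v)$ number of descendants; normal: endpoints of every edge of $G$ are comparable. $L(v)$: proper ancestors of $v$ adjacent to some descendant of $v$; $lwpt_k(v)$: $k$-th element of $L(v)$ closest to the root if $|L(v)|\ge k$, else $v$. Vertices are $[n]$; compatible numbering: descendants of each $j$ form $[j,j+ND(j)-1]$, and siblings $j<k$ satisfy $(-lwpt_1(j),lwpt_2(j))\le_{lex}(-lwpt_1(k),lwpt_2(k))$. A 2-separation with separator $\{a,b\}$ is type-2 if $r\notin\{a,b\}$, $V(T(a,b))\ne\emptyset$ and up to exchanging sides $r\in A\setminus B$, $V(T(a,b))\subseteq B\setminus A$; otherwise type-1. -}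

module Defs where

open import Data.Nat using (ℕ; zero; suc; _+_; _≤_; _<_)
open import Data.Fin using (Fin; toℕ)
open import Data.List using (List; []; _∷_)
open import Data.List.Membership.Propositional using (_∈_)
open import Data.List.Relation.Unary.Unique.Propositional using (Unique)
open import Data.Product using (Σ; ∃; ∃-syntax; _×_; _,_)
open import Data.Sum using (_⊎_)
open import Data.Empty using (⊥)
open import Relation.Nullary using (¬_)
open import Relation.Binary.PropositionalEquality using (_≡_; _≢_)

record Graph (n : ℕ) : Set₁ where
  field
    Adj    : Fin n → Fin n → Set
    sym    : ∀ {u v} → Adj u v → Adj v u
    irrefl : ∀ {v} → ¬ Adj v v
open Graph public

Vset : ℕ → Set₁
Vset n = Fin n → Set

-- walks inside a vertex set S (i.e. in the induced subgraph G[S])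
data Reach {n : ℕ} (G : Graph n) (S : Vset n) : Fin n → Fin n → Set where
  here : ∀ {v} → S v → Reach G S v v
  step : ∀ {u v w} → S u → Adj G u v → Reach G S v w → Reach G S u w

Connected : ∀ {n} → Graph n → Vset n → Set
Connected G S = ∀ u v → S u → S v → Reach G S u v

-- 2-connected: more than 2 vertices and G - X connected for |X| < 2
TwoConnected : ∀ {n} → Graph n → Set
TwoConnected {n} G = (3 ≤ n) × Connected G (λ _ → Data.Unit.⊤) × (∀ x → Connected G (λ v → v ≢ x))
  where import Data.Unit

iter : ∀ {A : Set} → (A → A) → ℕ → A → A
iter f zero    x = x
iter f (suc k) x = f (iter f k x)

record RootedTree (n : ℕ) : Set where
  field
    root       : Fin n
    parent     : Fin n → Fin n
    parent-root : parent root ≡ root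
    reaches-root : ∀ v → ∃[ k ] iter parent k v ≡ root
open RootedTree public

-- u is an ancestor of v (reflexive: v is an ancestor of itself);
-- equivalently v is a descendant of u
Anc : ∀ {n} → RootedTree n → Fin n → Fin n → Set
Anc T u v = ∃[ k ] iter (parent T) k v ≡ u

ProperAnc : ∀ {n} → RootedTree n → Fin n → Fin n → Set
ProperAnc T u v = Anc T u v × u ≢ v

TreeAdj : ∀ {n} → RootedTree n → Fin n → Fin n → Set
TreeAdj T u v = (parent T u ≡ v × u ≢ root T) ⊎ (parent T v ≡ u × v ≢ root T)

Spanning : ∀ {n} → Graph n → RootedTree n → Set
Spanning G T = ∀ u v → TreeAdj T u v → Adj G u v

Normal : ∀ {n} → Graph n → RootedTree n → Set
Normal G T = ∀ u v → Adj G u v → Anc T u v ⊎ Anc T v u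

data TWalk {n : ℕ} (T : RootedTree n) : Fin n → Fin n → List (Fin n) → Set where
  here : ∀ v → TWalk T v v (v ∷ [])
  step : ∀ {u v w p} → TreeAdj T u v → TWalk T v w p → TWalk T u w (u ∷ p)

-- v ∈ V(T(a,b)): v lies on the (unique) a–b path of T, v ∉ {a,b}
InTInterior : ∀ {n} → RootedTree n → Fin n → Fin n → Fin n → Set
InTInterior T a b v =
  (∃[ p ] (TWalk T a b p × Unique p × v ∈ p)) × v ≢ a × v ≢ b

-- L(v), lwpt₁, lwpt₂ (as relations: LwptK T v x means lwpt_K(v) = x)

L : ∀ {n} → Graph n → RootedTree n → Fin n → Fin n → Set
L G T v u = ProperAnc T u v × ∃[ w ] (Anc T v w × Adj G u w)

-- L(v) is a chain; lwpt₁ is its element closest to the root, or v if L(v) = ∅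
Lwpt1 : ∀ {n} → Graph n → RootedTree n → Fin n → Fin n → Set
Lwpt1 G T v x =
  (L G T v x × (∀ y → L G T v y → ¬ ProperAnc T y x))
  ⊎ ((∀ y → ¬ L G T v y) × x ≡ v)

Lwpt2 : ∀ {n} → Graph n → RootedTree n → Fin n → Fin n → Set
Lwpt2 G T v x =
  (L G T v x × ∃[ y ] (L G T v y × ProperAnc T y x
                       × (∀ z → L G T v z → ProperAnc T z x → z ≡ y)))
  ⊎ (¬ (∃[ y ] ∃[ z ] (L G T v y × L G T v z × y ≢ z)) × x ≡ v)

-- (-a₁, a₂) ≤lex (-b₁, b₂)
LexLe : ℕ → ℕ → ℕ → ℕ → Set
LexLe a₁ a₂ b₁ b₂ = (b₁ < a₁) ⊎ (a₁ ≡ b₁ × a₂ ≤ b₂)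

-- numbering (the identity numbering of Fin n) compatible with T
Compatible : ∀ {n} → Graph n → RootedTree n → Set
Compatible G T =
  -- descendants of j form the interval [j, j + ND(j) - 1]
  (∀ j → ∃[ m ] (∀ k → (Anc T j k → (toℕ j ≤ toℕ k × toℕ k < toℕ j + m))
                      × ((toℕ j ≤ toℕ k × toℕ k < toℕ j + m) → Anc T j k)))
  × (∀ j k → j ≢ root T → k ≢ root T → parent T j ≡ parent T k → toℕ j < toℕ k →
       ∀ x₁ x₂ y₁ y₂ → Lwpt1 G T j x₁ → Lwpt2 G T j x₂ → Lwpt1 G T k y₁ → Lwpt2 G T k y₂ →
       LexLe (toℕ x₁) (toℕ x₂) (toℕ y₁) (toℕ y₂))

_∖_ : ∀ {n} → Vset n → Vset n → Vset n
(A ∖ B) v = A v × ¬ B v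

_⊆_ : ∀ {n} → Vset n → Vset n → Set
A ⊆ B = ∀ v → A v → B v

IsSeparation : ∀ {n} → Graph n → Vset n → Vset n → Set
IsSeparation G A B =
  (∀ v → A v ⊎ B v)
  × (∃[ v ] (A ∖ B) v) × (∃[ v ] (B ∖ A) v)
  × (∀ u v → (A ∖ B) u → (B ∖ A) v → ¬ Adj G u v)

Separator : ∀ {n} → Vset n → Vset n → Fin n → Fin n → Set
Separator A B a b = a ≢ b × (∀ v → ((A v × B v) → (v ≡ a ⊎ v ≡ b)) × ((v ≡ a ⊎ v ≡ b) → (A v × B v)))

Is2Separation : ∀ {n} → Graph n → Vset n → Vset n → Set
Is2Separation G A B = IsSeparation G A B × ∃[ a ] ∃[ b ] Separator A B a b

Type2Side : ∀ {n} → RootedTree n → Vset n → Vset n → Fin n → Fin n → Set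
Type2Side T A B a b = (A ∖ B) (root T) × (∀ v → InTInterior T a b v → (B ∖ A) v)

IsType2 : ∀ {n} → Graph n → RootedTree n → Vset n → Vset n → Set
IsType2 G T A B = Is2Separation G A B × ∃[ a ] ∃[ b ] (Separator A B a b
  × root T ≢ a × root T ≢ b × (∃[ v ] InTInterior T a b v)
  × (Type2Side T A B a b ⊎ Type2Side T B A a b))

IsType1 : ∀ {n} → Graph n → RootedTree n → Vset n → Vset n → Set
IsType1 G T A B = Is2Separation G A B × ¬ IsType2 G T A B

HalfConnected : ∀ {n} → Graph n → Vset n → Vset n → Set
HalfConnected G A B = Connected G (A ∖ B) ⊎ Connected G (B ∖ A)

NestedOriented : ∀ {n} → Vset n → Vset n → Vset n → Vset n → Set
NestedOriented A B C D = A ⊆ C × D ⊆ B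

Nested : ∀ {n} → Vset n → Vset n → Vset n → Vset n → Set
Nested A B C D = NestedOriented A B C D ⊎ NestedOriented B A C D
               ⊎ NestedOriented A B D C ⊎ NestedOriented B A D C

module Submission where

-- The separator {a, b} of a 2-separation is comparable in T: otherwise normality and 2-connectivity join
-- every other vertex to the root avoiding a and b, and one strict side would be empty. Let {c, d} separate
-- (A′, B′). If c ∈ A ∖ B and d ∈ B ∖ A, then a and b lie on opposite strict sides of (A′, B′); following
-- the tree paths, each separator meets the other, which yields an ancestor chain p₁ < p₂ < p₃ < p₄ where
-- {p₂, p₄} separates one of the two separations with p₁ and p₃ on opposite sides, so that one is type-2.
-- Otherwise c and d lie in one side, say A, and a strict side of (A, B) — the connected one, or B ∖ A when
-- a or b is not in {c, d} — falls into a single strict side of (A′, B′), which gives nestedness.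

open import Data.Nat using (ℕ; zero; suc; _+_; _*_; _∸_; _≤_; z≤n; s≤s; _≤?_; _<?_)
open import Data.Nat.Properties using (≤-total; ≤-refl; ≤-trans; n≤1+n; m≤m*n; m∸n+n≡m; m≤n⇒m<n∨m≡n)
open import Data.Fin using (Fin; toℕ) renaming (_≟_ to _≟ᶠ_)
open import Data.List using (List; []; _∷_)
open import Data.List.Membership.Propositional using (_∈_)
open import Data.List.Relation.Unary.Any using (here; there)
open import Data.List.Relation.Unary.All as All using (All; []; _∷_)
open import Data.List.Relation.Unary.AllPairs using ([]; _∷_)
open import Data.List.Relation.Unary.Unique.Propositional using (Unique)
open import Data.Product using (∃; ∃-syntax; _×_; _,_; proj₁; proj₂)
import Data.Product as Product
open import Data.Sum using (_⊎_; inj₁; inj₂; [_,_]′)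
import Data.Sum as Sum
open import Data.Empty using (⊥-elim)
open import Relation.Nullary using (¬_; Dec; yes; no)
open import Relation.Binary.PropositionalEquality using (_≡_; _≢_; refl; sym; trans; cong; subst; ≢-sym; module ≡-Reasoning)
open import Function using (_∘_)
open import Defs hiding (sym)

iter-comm : ∀ {A : Set} (f : A → A) k x → iter f k (f x) ≡ f (iter f k x)
iter-comm f zero    x = refl
iter-comm f (suc k) x = cong f (iter-comm f k x)

iter-+ : ∀ {A : Set} (f : A → A) i j x → iter f (i + j) x ≡ iter f i (iter f j x)
iter-+ f zero    j x = refl
iter-+ f (suc i) j x = cong f (iter-+ f i j x)

module AncestorOrder {n : ℕ} (T : RootedTree n) where

  private
    r : Fin n
    r = root T
    par : Fin n → Fin n
    par = parent T

  iter-root : ∀ k → iter par k r ≡ r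
  iter-root zero    = refl
  iter-root (suc k) = trans (cong par (iter-root k)) (parent-root T)

  iter-root-absorbing : ∀ {v i j} → i ≤ j → iter par i v ≡ r → iter par j v ≡ r
  iter-root-absorbing {v} {i} {j} i≤j e = begin
    iter par j v                   ≡⟨ cong (λ k → iter par k v) (sym (m∸n+n≡m i≤j)) ⟩
    iter par (j ∸ i + i) v         ≡⟨ iter-+ par (j ∸ i) i v ⟩
    iter par (j ∸ i) (iter par i v) ≡⟨ cong (iter par (j ∸ i)) e ⟩
    iter par (j ∸ i) r             ≡⟨ iter-root (j ∸ i) ⟩
    r                              ∎
    where open ≡-Reasoning

  iter-periodic : ∀ {v} k q → iter par (suc k) v ≡ v → iter par (q * suc k) v ≡ v
  iter-periodic k zero    e = refl
  iter-periodic {v} k (suc q) e =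
    trans (iter-+ par (suc k) (q * suc k) v) (trans (cong (iter par (suc k)) (iter-periodic k q e)) e)

  -- v returns to itself after m·(k+1) steps, and m of these steps already lead to the root.
  periodic⇒root : ∀ {v} k → iter par (suc k) v ≡ v → v ≡ r
  periodic⇒root {v} k e with reaches-root T v
  ... | m , e′ = trans (sym (iter-periodic k m e)) (iter-root-absorbing (m≤m*n m (suc k)) e′)

  parent≢self : ∀ {v} → v ≢ r → par v ≢ v
  parent≢self v≢r e = v≢r (periodic⇒root 0 e)

  anc-refl : ∀ {u} → Anc T u u
  anc-refl = 0 , refl

  anc-trans : ∀ {u v w} → Anc T u v → Anc T v w → Anc T u w
  anc-trans {w = w} (i , e₁) (j , e₂) = i + j , trans (iter-+ par i j w) (trans (cong (iter par i) e₂) e₁)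

  anc-antisym : ∀ {u v} → Anc T u v → Anc T v u → u ≡ v
  anc-antisym (zero , e) _ = sym e
  anc-antisym {u} {v} (suc i , e₁) (j , e₂) = trans u≡r (sym v≡r)
    where
      u≡r : u ≡ r
      u≡r = periodic⇒root (i + j) (trans (iter-+ par (suc i) j u) (trans (cong (iter par (suc i)) e₂) e₁))
      v≡r : v ≡ r
      v≡r = trans (sym e₂) (trans (cong (iter par j) u≡r) (iter-root j))

  anc-root : ∀ v → Anc T r v
  anc-root = reaches-root T

  anc-of-root : ∀ {u} → Anc T u r → u ≡ r
  anc-of-root (k , e) = trans (sym e) (iter-root k)

  anc-parent : ∀ v → Anc T (par v) v
  anc-parent v = 1 , refl

  anc-from-parent : ∀ {u v} → Anc T u (par v) → Anc T u v
  anc-from-parent {v = v} (k , e) = suc k , trans (sym (iter-comm par k v)) e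

  anc-to-parent : ∀ {u v} → Anc T u v → u ≢ v → Anc T u (par v)
  anc-to-parent (zero , e)  u≢v = ⊥-elim (u≢v (sym e))
  anc-to-parent {v = v} (suc k , e) _ = k , trans (iter-comm par k v) e

  anc-iter-≤ : ∀ {x y v i j} → i ≤ j → iter par i v ≡ x → iter par j v ≡ y → Anc T y x
  anc-iter-≤ {x} {y} {v} {i} {j} i≤j eᵢ eⱼ =
    j ∸ i , trans (cong (iter par (j ∸ i)) (sym eᵢ))
              (trans (sym (iter-+ par (j ∸ i) i v)) (trans (cong (λ k → iter par k v) (m∸n+n≡m i≤j)) eⱼ))

  anc-comparable : ∀ {x y v} → Anc T x v → Anc T y v → Anc T x y ⊎ Anc T y x
  anc-comparable (i , eᵢ) (j , eⱼ) with ≤-total i j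
  ... | inj₁ i≤j = inj₂ (anc-iter-≤ i≤j eᵢ eⱼ)
  ... | inj₂ j≤i = inj₁ (anc-iter-≤ j≤i eⱼ eᵢ)

  properAnc⇒≢root : ∀ {u v} → ProperAnc T u v → v ≢ r
  properAnc⇒≢root (u≤v , u≢v) v≡r = u≢v (trans (anc-of-root (subst (Anc T _) v≡r u≤v)) (sym v≡r))

  Between : Fin n → Fin n → Vset n
  Between u v w = Anc T u w × Anc T w v

  StrictlyBetween : Fin n → Fin n → Vset n
  StrictlyBetween u v w = ProperAnc T u w × ProperAnc T w v

anc-dec : ∀ {n} {G : Graph n} {T : RootedTree n} → Compatible G T → ∀ u v → Dec (Anc T u v)
anc-dec (intervals , _) u v with intervals u
... | m , desc⇔ with toℕ u ≤? toℕ v | toℕ v <? toℕ u + m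
...   | yes u≤v | yes v<u+m = yes (proj₂ (desc⇔ v) (u≤v , v<u+m))
...   | no  u≰v | _         = no λ a → u≰v (proj₁ (proj₁ (desc⇔ v) a))
...   | yes _   | no v≮u+m  = no λ a → v≮u+m (proj₂ (proj₁ (desc⇔ v) a))

module Walks {n : ℕ} (G : Graph n) where

  reach-head : ∀ {P x y} → Reach G P x y → P x
  reach-head (here p)     = p
  reach-head (step p _ _) = p

  reach-last : ∀ {P x y} → Reach G P x y → P y
  reach-last (here p)        = p
  reach-last (step _ _ rest) = reach-last rest

  reach-mono : ∀ {P Q : Vset n} {x y} → P ⊆ Q → Reach G P x y → Reach G Q x y
  reach-mono P⊆Q (here p)        = here (P⊆Q _ p)
  reach-mono P⊆Q (step p a rest) = step (P⊆Q _ p) a (reach-mono P⊆Q rest)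

  reach-++ : ∀ {P x y z} → Reach G P x y → Reach G P y z → Reach G P x z
  reach-++ (here _)        q = q
  reach-++ (step p a rest) q = step p a (reach-++ rest q)

  reach-reverse : ∀ {P x y} → Reach G P x y → Reach G P y x
  reach-reverse (here p)        = here p
  reach-reverse (step p a rest) = reach-++ (reach-reverse rest) (step (reach-head rest) (Graph.sym G a) (here p))

  reach-exit : ∀ {Q : Vset n} {x y} (P : Vset n) → (∀ v → Dec (P v)) → Reach G Q x y → P x → ¬ P y →
               ∃[ w ] ∃[ z ] (Reach G (λ v → Q v × P v) x w × Adj G w z × Q z × ¬ P z)
  reach-exit P P? (here _) px ¬py = ⊥-elim (¬py px)
  reach-exit P P? (step {u} {v} q a rest) px ¬py with P? v
  ... | no ¬pv = u , v , here (q , px) , a , reach-head rest , ¬pv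
  ... | yes pv with reach-exit P P? rest pv ¬py
  ...   | w , z , walk , w~z , qz , ¬pz = w , z , step (q , px) a walk , w~z , qz , ¬pz

Avoids : ∀ {n} → Fin n → Fin n → Vset n
Avoids s t v = v ≢ s × v ≢ t

Opposite : ∀ {n} → Vset n → Vset n → Fin n → Fin n → Set
Opposite X Y u v = ((X ∖ Y) u × (Y ∖ X) v) ⊎ ((Y ∖ X) u × (X ∖ Y) v)

opposite-swap : ∀ {n} {X Y : Vset n} {u v} → Opposite X Y u v → Opposite X Y v u
opposite-swap = Sum.swap ∘ Sum.map Product.swap Product.swap

nested-swapˡ : ∀ {n} {A B C D : Vset n} → Nested A B C D → Nested B A C D
nested-swapˡ (inj₁ o)                = inj₂ (inj₁ o)
nested-swapˡ (inj₂ (inj₁ o))         = inj₁ o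
nested-swapˡ (inj₂ (inj₂ (inj₁ o)))  = inj₂ (inj₂ (inj₂ o))
nested-swapˡ (inj₂ (inj₂ (inj₂ o)))  = inj₂ (inj₂ (inj₁ o))

module Separations {n : ℕ} (G : Graph n) where
  open Walks G

  record TwoSep (X Y : Vset n) (s t : Fin n) : Set where
    field
      cover      : ∀ v → X v ⊎ Y v
      inhabitedˡ : ∃ (X ∖ Y)
      inhabitedʳ : ∃ (Y ∖ X)
      no-edge    : ∀ u v → (X ∖ Y) u → (Y ∖ X) v → ¬ Adj G u v
      s≢t        : s ≢ t
      X∩Y⊆st     : ∀ v → X v → Y v → v ≡ s ⊎ v ≡ t
      Xs         : X s
      Ys         : Y s
      Xt         : X t
      Yt         : Y t
  open TwoSep public

  two-sep : ∀ {X Y} (S : Is2Separation G X Y) → TwoSep X Y (proj₁ (proj₂ S)) (proj₁ (proj₂ (proj₂ S)))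
  two-sep ((cov , inhˡ , inhʳ , ne) , s , t , s≢t , st⇔) = record
    { cover = cov ; inhabitedˡ = inhˡ ; inhabitedʳ = inhʳ ; no-edge = ne ; s≢t = s≢t
    ; X∩Y⊆st = λ v x y → proj₁ (st⇔ v) (x , y)
    ; Xs = proj₁ (proj₂ (st⇔ s) (inj₁ refl)) ; Ys = proj₂ (proj₂ (st⇔ s) (inj₁ refl))
    ; Xt = proj₁ (proj₂ (st⇔ t) (inj₂ refl)) ; Yt = proj₂ (proj₂ (st⇔ t) (inj₂ refl)) }

  separator-in-both : ∀ {X Y s t v} → TwoSep X Y s t → v ≡ s ⊎ v ≡ t → X v × Y v
  separator-in-both S (inj₁ refl) = Xs S , Ys S
  separator-in-both S (inj₂ refl) = Xt S , Yt S

  separator : ∀ {X Y s t} → TwoSep X Y s t → Separator X Y s t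
  separator S = s≢t S , λ v → (λ (x , y) → X∩Y⊆st S v x y) , separator-in-both S

  is2-separation : ∀ {X Y s t} → TwoSep X Y s t → Is2Separation G X Y
  is2-separation {s = s} {t} S = (cover S , inhabitedˡ S , inhabitedʳ S , no-edge S) , s , t , separator S

  flip-sides : ∀ {X Y s t} → TwoSep X Y s t → TwoSep Y X s t
  flip-sides S = record
    { cover = Sum.swap ∘ cover S ; inhabitedˡ = inhabitedʳ S ; inhabitedʳ = inhabitedˡ S
    ; no-edge = λ u v u∈ v∈ a → no-edge S v u v∈ u∈ (Graph.sym G a) ; s≢t = s≢t S
    ; X∩Y⊆st = λ v y x → X∩Y⊆st S v x y
    ; Xs = Ys S ; Ys = Xs S ; Xt = Yt S ; Yt = Xt S }

  flip-separator : ∀ {X Y s t} → TwoSep X Y s t → TwoSep X Y t s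
  flip-separator S = record
    { cover = cover S ; inhabitedˡ = inhabitedˡ S ; inhabitedʳ = inhabitedʳ S
    ; no-edge = no-edge S ; s≢t = ≢-sym (s≢t S)
    ; X∩Y⊆st = λ v x y → Sum.swap (X∩Y⊆st S v x y)
    ; Xs = Xt S ; Ys = Yt S ; Xt = Xs S ; Yt = Ys S }

  data Position (X Y : Vset n) (s t v : Fin n) : Set where
    strictˡ : (X ∖ Y) v → Position X Y s t v
    strictʳ : (Y ∖ X) v → Position X Y s t v
    at-s    : v ≡ s → Position X Y s t v
    at-t    : v ≡ t → Position X Y s t v

  position : ∀ {X Y s t} → TwoSep X Y s t → ∀ v → Position X Y s t v
  position {s = s} {t} S v with v ≟ᶠ s | v ≟ᶠ t
  ... | yes v≡s | _       = at-s v≡s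
  ... | no _    | yes v≡t = at-t v≡t
  ... | no v≢s  | no v≢t with cover S v
  ...   | inj₁ x = strictˡ (x , λ y → [ v≢s , v≢t ]′ (X∩Y⊆st S v x y))
  ...   | inj₂ y = strictʳ (y , λ x → [ v≢s , v≢t ]′ (X∩Y⊆st S v x y))

  side-or-strict : ∀ {X Y s t} → TwoSep X Y s t → ∀ v → X v ⊎ (Y ∖ X) v
  side-or-strict S v with position S v
  ... | strictˡ v∈ = inj₁ (proj₁ v∈)
  ... | strictʳ v∈ = inj₂ v∈
  ... | at-s refl  = inj₁ (Xs S)
  ... | at-t refl  = inj₁ (Xt S)

  same-side-or-crossing : ∀ {A B a b} → TwoSep A B a b → ∀ c d →
    (A c × A d) ⊎ (B c × B d) ⊎ ((A ∖ B) c × (B ∖ A) d) ⊎ ((B ∖ A) c × (A ∖ B) d)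
  same-side-or-crossing S c d with side-or-strict S c | side-or-strict S d
  ... | inj₁ Ac  | inj₁ Ad  = inj₁ (Ac , Ad)
  ... | inj₂ c∈  | inj₂ d∈  = inj₂ (inj₁ (proj₁ c∈ , proj₁ d∈))
  ... | inj₂ c∈  | inj₁ Ad  with side-or-strict (flip-sides S) d
  ...   | inj₁ Bd = inj₂ (inj₁ (proj₁ c∈ , Bd))
  ...   | inj₂ d∈ = inj₂ (inj₂ (inj₂ (c∈ , d∈)))
  same-side-or-crossing S c d | inj₁ Ac | inj₂ d∈ with side-or-strict (flip-sides S) c
  ...   | inj₁ Bc = inj₂ (inj₁ (Bc , proj₁ d∈))
  ...   | inj₂ c∈ = inj₂ (inj₂ (inj₁ (c∈ , d∈)))

  strict-dec : ∀ {X Y s t} → TwoSep X Y s t → ∀ v → Dec ((X ∖ Y) v)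
  strict-dec S v with position S v
  ... | strictˡ v∈ = yes v∈
  ... | strictʳ v∈ = no λ v∈′ → proj₂ v∈′ (proj₁ v∈)
  ... | at-s refl  = no λ v∈′ → proj₂ v∈′ (Ys S)
  ... | at-t refl  = no λ v∈′ → proj₂ v∈′ (Yt S)

  outside-avoids : ∀ {Y : Vset n} {s t v} → Y s → Y t → ¬ Y v → Avoids s t v
  outside-avoids Y∋s Y∋t v∉Y = (λ { refl → v∉Y Y∋s }) , (λ { refl → v∉Y Y∋t })

  adj-strict⇒side : ∀ {X Y s t w z} → TwoSep X Y s t → (X ∖ Y) w → Adj G w z → X z
  adj-strict⇒side S w∈ w~z with position S _
  ... | strictˡ z∈ = proj₁ z∈
  ... | strictʳ z∈ = ⊥-elim (no-edge S _ _ w∈ z∈ w~z)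
  ... | at-s refl  = Xs S
  ... | at-t refl  = Xt S

  step-side : ∀ {X Y s t u v} → TwoSep X Y s t → Adj G u v → (X ∖ Y) u → Avoids s t v → (X ∖ Y) v
  step-side S u~v u∈ (v≢s , v≢t) with position S _
  ... | strictˡ v∈ = v∈
  ... | strictʳ v∈ = ⊥-elim (no-edge S _ _ u∈ v∈ u~v)
  ... | at-s v≡s   = ⊥-elim (v≢s v≡s)
  ... | at-t v≡t   = ⊥-elim (v≢t v≡t)

  walk-side : ∀ {X Y s t x y} → TwoSep X Y s t → Reach G (Avoids s t) x y → (X ∖ Y) x → (X ∖ Y) y
  walk-side S (here _)          x∈ = x∈
  walk-side S (step _ x~v rest) x∈ = walk-side S rest (step-side S x~v x∈ (reach-head rest))

  walk-meets-separator : ∀ {X Y s t P x y} → TwoSep X Y s t → Reach G P x y → (X ∖ Y) x → (Y ∖ X) y →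
                         ∃[ m ] (P m × (m ≡ s ⊎ m ≡ t))
  walk-meets-separator S (here _) x∈ y∈ = ⊥-elim (proj₂ x∈ (proj₁ y∈))
  walk-meets-separator S (step _ x~v rest) x∈ y∈ with position S _
  ... | strictˡ v∈ = walk-meets-separator S rest v∈ y∈
  ... | strictʳ v∈ = ⊥-elim (no-edge S _ _ x∈ v∈ x~v)
  ... | at-s v≡s   = _ , reach-head rest , inj₁ v≡s
  ... | at-t v≡t   = _ , reach-head rest , inj₂ v≡t

  opposite-avoids : ∀ {X Y s t u v} → TwoSep X Y s t → Opposite X Y u v → Avoids s t u × Avoids s t v
  opposite-avoids S (inj₁ (u∈ , v∈)) =
    outside-avoids (Ys S) (Yt S) (proj₂ u∈) , outside-avoids (Xs S) (Xt S) (proj₂ v∈)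
  opposite-avoids S (inj₂ (u∈ , v∈)) =
    outside-avoids (Xs S) (Xt S) (proj₂ u∈) , outside-avoids (Ys S) (Yt S) (proj₂ v∈)

  strict-walk-avoids : ∀ {X Y : Vset n} {s t x y} → Y s → Y t → Reach G (X ∖ Y) x y → Reach G (Avoids s t) x y
  strict-walk-avoids Y∋s Y∋t = reach-mono (λ _ v∈ → outside-avoids Y∋s Y∋t (proj₂ v∈))

module TwoConnectedSeparations {n : ℕ} (G : Graph n) (conn : ∀ x → Connected G (λ v → v ≢ x)) where
  open Walks G
  open Separations G

  -- G − t is connected, so a walk in G − t from v to the other strict side leaves Y ∖ X through s.
  separator-neighbour : ∀ {X Y s t v} → TwoSep X Y s t → (Y ∖ X) v → ∃[ w ] (Reach G (Y ∖ X) v w × Adj G w s)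
  separator-neighbour {X} {Y} {s} {t} {v} S v∈ with inhabitedˡ S
  ... | u , u∈ with reach-exit (Y ∖ X) (strict-dec (flip-sides S))
                      (conn t v u (proj₂ (outside-avoids (Xs S) (Xt S) (proj₂ v∈)))
                                  (proj₂ (outside-avoids (Ys S) (Yt S) (proj₂ u∈))))
                      v∈ (λ u∈′ → proj₂ u∈ (proj₁ u∈′))
  ...   | w , z , walk , w~z , z≢t , z∉ with position S z
  ...     | strictˡ z∈ = ⊥-elim (no-edge S z w z∈ (proj₂ (reach-last walk)) (Graph.sym G w~z))
  ...     | strictʳ z∈ = ⊥-elim (z∉ z∈)
  ...     | at-s refl  = w , reach-mono (λ _ → proj₂) walk , w~z
  ...     | at-t z≡t   = ⊥-elim (z≢t z≡t)

  -- A vertex of D ∖ C reaches neighbours of c and of d inside D ∖ C, hence avoiding a, b ∈ C;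
  -- whichever strict side of (A, B) it lies in, one of these walks joins A ∖ B to B ∖ A.
  crossing-splits-separator : ∀ {A B C D a b c d} → TwoSep A B a b → TwoSep C D c d →
                              (A ∖ B) c → (B ∖ A) d → ¬ (C a × C b)
  crossing-splits-separator SAB SCD c∈ d∈ (Ca , Cb) with inhabitedʳ SCD
  ... | v , v∈ with separator-neighbour SCD v∈ | separator-neighbour (flip-separator SCD) v∈ | position SAB v
  ...   | _ , to-wc , wc~c | _ , to-wd , wd~d | strictˡ v∈A =
          no-edge SAB _ _ (walk-side SAB (strict-walk-avoids Ca Cb to-wd) v∈A) d∈ wd~d
  ...   | _ , to-wc , wc~c | _ , to-wd , wd~d | strictʳ v∈B =
          no-edge SAB _ _ c∈ (walk-side (flip-sides SAB) (strict-walk-avoids Ca Cb to-wc) v∈B) (Graph.sym G wc~c)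
  ...   | _ | _ | at-s refl = proj₂ v∈ Ca
  ...   | _ | _ | at-t refl = proj₂ v∈ Cb

  crossing⇒opposite : ∀ {A B C D a b c d} → TwoSep A B a b → TwoSep C D c d →
                      (A ∖ B) c → (B ∖ A) d → Opposite C D a b
  crossing⇒opposite SAB SCD c∈ d∈ with position SCD _ | position SCD _
  ... | strictˡ a∈ | strictʳ b∈ = inj₁ (a∈ , b∈)
  ... | strictʳ a∈ | strictˡ b∈ = inj₂ (a∈ , b∈)
  ... | strictˡ a∈ | strictˡ b∈ = ⊥-elim (crossing-splits-separator SAB SCD c∈ d∈ (proj₁ a∈ , proj₁ b∈))
  ... | strictʳ a∈ | strictʳ b∈ = ⊥-elim (crossing-splits-separator SAB (flip-sides SCD) c∈ d∈ (proj₁ a∈ , proj₁ b∈))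
  ... | at-s refl | _ = ⊥-elim (proj₂ c∈ (Ys SAB))
  ... | at-t refl | _ = ⊥-elim (proj₂ d∈ (Xs SAB))
  ... | _ | at-s refl = ⊥-elim (proj₂ c∈ (Yt SAB))
  ... | _ | at-t refl = ⊥-elim (proj₂ d∈ (Xt SAB))

  separator-in-side : ∀ {A B C D s t c d v} → TwoSep A B s t → TwoSep C D c d → A c → A d →
                      (B ∖ A) v → (C ∖ D) v → C s
  separator-in-side SAB SCD Ac Ad v∈B v∈C with separator-neighbour SAB v∈B
  ... | w , to-w , w~s = adj-strict⇒side SCD (walk-side SCD (strict-walk-avoids Ac Ad to-w) v∈C) w~s

  nested-if-strict-side-inside : ∀ {A B C D a b c d} → TwoSep A B a b → TwoSep C D c d → A c → A d →
                                 (B ∖ A) ⊆ (C ∖ D) → NestedOriented B A C D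
  nested-if-strict-side-inside {A} {B} {C} {D} SAB SCD Ac Ad BA⊆CD = B⊆C , D⊆A
    where
      B⊆C : B ⊆ C
      B⊆C v v∈B with position SAB v | inhabitedʳ SAB
      ... | strictˡ v∈ | _ = ⊥-elim (proj₂ v∈ v∈B)
      ... | strictʳ v∈ | _ = proj₁ (BA⊆CD v v∈)
      ... | at-s refl | u , u∈ = separator-in-side SAB SCD Ac Ad u∈ (BA⊆CD u u∈)
      ... | at-t refl | u , u∈ = separator-in-side (flip-separator SAB) SCD Ac Ad u∈ (BA⊆CD u u∈)
      D⊆A : D ⊆ A
      D⊆A v v∈D with position SAB v
      ... | strictˡ v∈ = proj₁ v∈
      ... | strictʳ v∈ = ⊥-elim (proj₂ (BA⊆CD v v∈) v∈D)
      ... | at-s refl  = Xs SAB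
      ... | at-t refl  = Xt SAB

  nested-by-propagation : ∀ {A B C D a b c d} → TwoSep A B a b → TwoSep C D c d → A c → A d →
    (∀ {X Y} → TwoSep X Y c d → ∀ {v} → (B ∖ A) v → (X ∖ Y) v → (B ∖ A) ⊆ (X ∖ Y)) →
    Nested A B C D
  nested-by-propagation SAB SCD Ac Ad propagate with inhabitedʳ SAB
  ... | v , v∈ with position SCD v
  ...   | strictˡ v∈C = inj₂ (inj₁ (nested-if-strict-side-inside SAB SCD Ac Ad (propagate SCD v∈ v∈C)))
  ...   | strictʳ v∈D = inj₂ (inj₂ (inj₂
          (nested-if-strict-side-inside SAB (flip-sides SCD) Ac Ad (propagate (flip-sides SCD) v∈ v∈D))))
  ...   | at-s refl = ⊥-elim (proj₂ v∈ Ac)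
  ...   | at-t refl = ⊥-elim (proj₂ v∈ Ad)

  connected-side-inside : ∀ {A B C D c d} → Connected G (B ∖ A) → A c → A d → TwoSep C D c d →
                          ∀ {v} → (B ∖ A) v → (C ∖ D) v → (B ∖ A) ⊆ (C ∖ D)
  connected-side-inside con Ac Ad SCD v∈ v∈C u u∈ = walk-side SCD (strict-walk-avoids Ac Ad (con _ u v∈ u∈)) v∈C

  -- Otherwise a would lie in C (via v) and in D (via u), so in {c, d}.
  side-inside-if-separator-outside : ∀ {A B C D a b c d} → TwoSep A B a b → A c → A d → a ≢ c → a ≢ d →
                                     TwoSep C D c d → ∀ {v} → (B ∖ A) v → (C ∖ D) v → (B ∖ A) ⊆ (C ∖ D)
  side-inside-if-separator-outside {a = a} SAB Ac Ad a≢c a≢d SCD v∈ v∈C u u∈ with position SCD u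
  ... | strictˡ u∈C = u∈C
  ... | strictʳ u∈D = ⊥-elim ([ a≢c , a≢d ]′ (X∩Y⊆st SCD a (separator-in-side SAB SCD Ac Ad v∈ v∈C)
                                                  (separator-in-side SAB (flip-sides SCD) Ac Ad u∈ u∈D)))
  ... | at-s refl = ⊥-elim (proj₂ u∈ Ac)
  ... | at-t refl = ⊥-elim (proj₂ u∈ Ad)

  nested-if-same-separator : ∀ {A B C D a b c d} → TwoSep A B a b → TwoSep C D c d → HalfConnected G A B →
                             A c → A d → B c → B d → Nested A B C D
  nested-if-same-separator SAB SCD (inj₁ con) Ac Ad Bc Bd =
    nested-swapˡ (nested-by-propagation (flip-sides SAB) SCD Bc Bd (connected-side-inside con Bc Bd))
  nested-if-same-separator SAB SCD (inj₂ con) Ac Ad Bc Bd =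
    nested-by-propagation SAB SCD Ac Ad (connected-side-inside con Ac Ad)

  nested-if-separator-in-side : ∀ {A B C D a b c d} → TwoSep A B a b → TwoSep C D c d → HalfConnected G A B →
                                A c → A d → Nested A B C D
  nested-if-separator-in-side {a = a} {b} {c = c} {d} SAB SCD hc Ac Ad with a ≟ᶠ c | a ≟ᶠ d | b ≟ᶠ c | b ≟ᶠ d
  ... | no a≢c | no a≢d | _ | _ =
        nested-by-propagation SAB SCD Ac Ad (side-inside-if-separator-outside SAB Ac Ad a≢c a≢d)
  ... | _ | _ | no b≢c | no b≢d =
        nested-by-propagation SAB SCD Ac Ad (side-inside-if-separator-outside (flip-separator SAB) Ac Ad b≢c b≢d)
  ... | yes refl | _ | yes refl | _ = ⊥-elim (s≢t SAB refl)
  ... | _ | yes refl | _ | yes refl = ⊥-elim (s≢t SAB refl)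
  ... | yes refl | _ | no _ | yes refl = nested-if-same-separator SAB SCD hc Ac Ad (Ys SAB) (Yt SAB)
  ... | no _ | yes refl | yes refl | _ = nested-if-same-separator SAB SCD hc Ac Ad (Yt SAB) (Ys SAB)

module NormalTreeSeparations {n : ℕ} (G : Graph n) (T : RootedTree n) (spanning : Spanning G T)
  (normal : Normal G T) (conn : ∀ x → Connected G (λ v → v ≢ x)) (anc? : ∀ u v → Dec (Anc T u v)) where
  open AncestorOrder T
  open Walks G
  open Separations G
  open TwoConnectedSeparations G conn

  private
    r : Fin n
    r = root T
    par : Fin n → Fin n
    par = parent T

  ancestor-walk : ∀ {P : Vset n} {u v} → Anc T u v → (∀ w → Between u v w → P w) → Reach G P v u
  ancestor-walk {P} {u} (k , e) = go k e
    where
      go : ∀ k {v} → iter par k v ≡ u → (∀ w → Between u v w → P w) → Reach G P v u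
      go zero    refl P-between = here (P-between _ (anc-refl , anc-refl))
      go (suc k) {v} e P-between with v ≟ᶠ u
      ... | yes refl = here (P-between v (anc-refl , anc-refl))
      ... | no v≢u   =
            step (P-between v ((suc k , e) , anc-refl))
                 (spanning v (par v) (inj₁ (refl , properAnc⇒≢root ((suc k , e) , ≢-sym v≢u))))
                 (go k (trans (iter-comm par k v) e) λ w (u≤w , w≤pv) → P-between w (u≤w , anc-from-parent w≤pv))

  root-walk : ∀ {P : Vset n} {v} → (∀ w → Anc T w v → P w) → Reach G P v r
  root-walk P-anc = ancestor-walk (anc-root _) (λ w → P-anc w ∘ proj₂)

  between-avoids : ∀ {s t u v w} → StrictlyBetween s t u → StrictlyBetween s t v → Between u v w → Avoids s t w
  between-avoids (s<u , _) (_ , v<t) (u≤w , w≤v) =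
    (λ { refl → proj₂ s<u (anc-antisym (proj₁ s<u) u≤w) }) ,
    (λ { refl → proj₂ v<t (anc-antisym (proj₁ v<t) w≤v) })

  interval-walk : ∀ {s t x y} → StrictlyBetween s t x → StrictlyBetween s t y → Reach G (Avoids s t) x y
  interval-walk x∈ y∈ with anc-comparable (proj₁ (proj₂ x∈)) (proj₁ (proj₂ y∈))
  ... | inj₁ x≤y = reach-reverse (ancestor-walk x≤y (λ _ → between-avoids x∈ y∈))
  ... | inj₂ y≤x = ancestor-walk y≤x (λ _ → between-avoids y∈ x∈)

  separator-between : ∀ {X Y s t x y} → TwoSep X Y s t → Opposite X Y x y → Anc T x y →
                      ∃[ m ] (Between x y m × (m ≡ s ⊎ m ≡ t))
  separator-between S (inj₁ (x∈ , y∈)) x≤y = walk-meets-separator (flip-sides S) (ancestor-walk x≤y λ _ b → b) y∈ x∈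
  separator-between S (inj₂ (x∈ , y∈)) x≤y = walk-meets-separator S (ancestor-walk x≤y λ _ b → b) y∈ x∈

  properAnc? : ∀ u v → Dec (ProperAnc T u v)
  properAnc? u v with anc? u v | u ≟ᶠ v
  ... | yes u≤v | no u≢v  = yes (u≤v , u≢v)
  ... | yes _   | yes u≡v = no λ u<v → proj₂ u<v u≡v
  ... | no u≰v  | _       = no λ u<v → u≰v (proj₁ u<v)

  -- A walk in G − s from x to the root leaves the subtree of s along an edge wz; by normality z is an
  -- ancestor of w, hence a proper ancestor of s, and the tree path from z to the root avoids s and t.
  subtree-escape : ∀ {s t x} → ¬ Anc T s t → ¬ Anc T t s → ProperAnc T s x → x ≢ t → Reach G (Avoids s t) x r
  subtree-escape {s} {t} {x} s≰t t≰s s<x x≢t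
    with reach-exit (ProperAnc T s) (properAnc? s) (conn s x r (≢-sym (proj₂ s<x)) (s≰t ∘ λ r≡s → subst (λ z → Anc T z t) r≡s (anc-root t))) s<x
                    (λ s<r → proj₂ s<r (anc-of-root (proj₁ s<r)))
  ... | w , z , to-w , w~z , z≢s , z∉ with normal w z w~z | proj₁ (proj₂ (reach-last to-w))
  ...   | inj₁ w≤z | s≤w = ⊥-elim (z∉ (anc-trans s≤w w≤z , ≢-sym z≢s))
  ...   | inj₂ z≤w | s≤w with anc-comparable s≤w z≤w
  ...     | inj₁ s≤z = ⊥-elim (z∉ (s≤z , ≢-sym z≢s))
  ...     | inj₂ z≤s =
            reach-++ (reach-mono (λ _ → inside-avoids) to-w)
                     (step (inside-avoids (reach-last to-w)) w~z
                       (root-walk λ v v≤z → (λ { refl → z≢s (anc-antisym z≤s v≤z) }) ,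
                                             (λ { refl → t≰s (anc-trans v≤z z≤s) })))
    where
      inside-avoids : ∀ {v} → v ≢ s × ProperAnc T s v → Avoids s t v
      inside-avoids (v≢s , s≤v , _) = v≢s , λ { refl → s≰t s≤v }

  walk-to-root-avoiding : ∀ {s t x} → ¬ Anc T s t → ¬ Anc T t s → Avoids s t x → Reach G (Avoids s t) x r
  walk-to-root-avoiding {s} {t} {x} s≰t t≰s (x≢s , x≢t) with anc? s x | anc? t x
  ... | yes s≤x | _       = subtree-escape s≰t t≰s (s≤x , ≢-sym x≢s) x≢t
  ... | no _    | yes t≤x = reach-mono (λ _ → Product.swap) (subtree-escape t≰s s≰t (t≤x , ≢-sym x≢t) x≢s)
  ... | no s≰x  | no t≰x  = root-walk λ w w≤x → (λ { refl → s≰x w≤x }) , (λ { refl → t≰x w≤x })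

  -- Otherwise both strict sides would be joined to the root avoiding s and t.
  separator-comparable : ∀ {X Y s t} → TwoSep X Y s t → Anc T s t ⊎ Anc T t s
  separator-comparable {s = s} {t} S with anc? s t | anc? t s
  ... | yes s≤t | _       = inj₁ s≤t
  ... | no _    | yes t≤s = inj₂ t≤s
  ... | no s≰t  | no t≰s with inhabitedˡ S | inhabitedʳ S
  ...   | x , x∈ | y , y∈ = ⊥-elim (proj₂ y∈ (proj₁ (walk-side S x→y x∈)))
    where
      x→y = reach-++ (walk-to-root-avoiding s≰t t≰s (outside-avoids (Ys S) (Yt S) (proj₂ x∈)))
                     (reach-reverse (walk-to-root-avoiding s≰t t≰s (outside-avoids (Xs S) (Xt S) (proj₂ y∈))))

  ancestor-list : Fin n → ℕ → List (Fin n)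
  ancestor-list x zero    = x ∷ []
  ancestor-list x (suc k) = iter par (suc k) x ∷ ancestor-list x k

  ancestor-twalk : ∀ x k → iter par k x ≢ r → TWalk T (iter par k x) x (ancestor-list x k)
  ancestor-twalk x zero    _   = here x
  ancestor-twalk x (suc k) top≢r = step (inj₂ (refl , k≢r)) (ancestor-twalk x k k≢r)
    where
      k≢r : iter par k x ≢ r
      k≢r = top≢r ∘ iter-root-absorbing (n≤1+n k)

  ∈-ancestor-list : ∀ x {k j} → j ≤ k → iter par j x ∈ ancestor-list x k
  ∈-ancestor-list x {zero}  z≤n = here refl
  ∈-ancestor-list x {suc k} j≤ with m≤n⇒m<n∨m≡n j≤
  ... | inj₁ (s≤s j≤k) = there (∈-ancestor-list x j≤k)
  ... | inj₂ refl      = here refl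

  ancestor-list-∈ : ∀ x k {y} → y ∈ ancestor-list x k → ∃[ j ] (j ≤ k × y ≡ iter par j x)
  ancestor-list-∈ x zero    (here e) = 0 , z≤n , e
  ancestor-list-∈ x (suc k) (here e) = suc k , ≤-refl , e
  ancestor-list-∈ x (suc k) (there y∈) with ancestor-list-∈ x k y∈
  ... | j , j≤k , e = j , ≤-trans j≤k (n≤1+n k) , e

  -- A repetition iter (k+1) x = iter j x with j ≤ k makes iter j x periodic, hence the root.
  ancestor-list-unique : ∀ x k → iter par k x ≢ r → Unique (ancestor-list x k)
  ancestor-list-unique x zero    _     = [] ∷ []
  ancestor-list-unique x (suc k) top≢r = All.tabulate fresh ∷ ancestor-list-unique x k k≢r
    where
      k≢r : iter par k x ≢ r
      k≢r = top≢r ∘ iter-root-absorbing (n≤1+n k)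
      fresh : ∀ {y} → y ∈ ancestor-list x k → iter par (suc k) x ≢ y
      fresh y∈ e with ancestor-list-∈ x k y∈
      ... | j , j≤k , refl = k≢r (iter-root-absorbing j≤k (periodic⇒root (k ∸ j)
              (trans (sym (iter-+ par (suc (k ∸ j)) j x)) (trans (cong (λ i → iter par (suc i) x) (m∸n+n≡m j≤k)) e))))

  interior-witness : ∀ {p₂ p₃ p₄} → r ≢ p₂ → StrictlyBetween p₂ p₄ p₃ → ∃ (InTInterior T p₂ p₄)
  interior-witness {p₂} {p₃} {p₄} r≢p₂ ((p₂≤p₃ , p₂≢p₃) , (p₃≤p₄@(i , eᵢ) , p₃≢p₄)) with anc-trans p₂≤p₃ p₃≤p₄
  ... | k , eₖ with ≤-total i k
  ...   | inj₂ k≤i = ⊥-elim (p₂≢p₃ (anc-antisym p₂≤p₃ (anc-iter-≤ k≤i eₖ eᵢ)))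
  ...   | inj₁ i≤k =
          p₃ , (ancestor-list p₄ k ,
                subst (λ z → TWalk T z p₄ (ancestor-list p₄ k)) eₖ (ancestor-twalk p₄ k k≢r) ,
                ancestor-list-unique p₄ k k≢r ,
                subst (_∈ ancestor-list p₄ k) eᵢ (∈-ancestor-list p₄ i≤k)) ,
          ≢-sym p₂≢p₃ , p₃≢p₄
    where
      k≢r : iter par k p₄ ≢ r
      k≢r e = r≢p₂ (trans (sym e) eₖ)

  twalk-head∈ : ∀ {a b q} → TWalk T a b q → a ∈ q
  twalk-head∈ (here _)   = here refl
  twalk-head∈ (step _ _) = here refl

  twalk-last∈ : ∀ {a b q} → TWalk T a b q → b ∈ q
  twalk-last∈ (here _)   = here refl
  twalk-last∈ (step _ w) = there (twalk-last∈ w)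

  closed-twalk : ∀ {a q v} → TWalk T a a q → Unique q → v ∈ q → v ≡ a
  closed-twalk (here _)   _             (here v≡a)  = v≡a
  closed-twalk (step _ _) _             (here v≡a)  = v≡a
  closed-twalk (step _ w) (a∉ ∷ _)      (there _)   = ⊥-elim (All.lookup a∉ (twalk-last∈ w) refl)

  twalk-preserves : ∀ {s x y q} (P : Vset n) → (∀ {w w′} → TreeAdj T w w′ → w′ ≢ s → P w → P w′) →
                    TWalk T x y q → All (s ≢_) q → P x → P y
  twalk-preserves P step-P (here _)    _           px = px
  twalk-preserves P step-P (step ta w) (_ ∷ s∉)    px =
    twalk-preserves P step-P w s∉ (step-P ta (≢-sym (All.lookup s∉ (twalk-head∈ w))) px)

  twalk-from-child : ∀ {s u y q} → par u ≡ s → TWalk T u y q → All (s ≢_) q → Anc T u y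
  twalk-from-child {s} {u} par-u≡s w s∉ = twalk-preserves (Anc T u) stays-below w s∉ anc-refl
    where
      stays-below : ∀ {w w′} → TreeAdj T w w′ → w′ ≢ s → Anc T u w → Anc T u w′
      stays-below (inj₁ (refl , _)) w′≢s u≤w = anc-to-parent u≤w λ { refl → w′≢s par-u≡s }
      stays-below (inj₂ (refl , _)) _    u≤w = anc-from-parent u≤w

  twalk-from-parent : ∀ {s u y q} → par s ≡ u → s ≢ r → TWalk T u y q → All (s ≢_) q → ¬ Anc T s y
  twalk-from-parent {s} refl s≢r w s∉ = twalk-preserves (λ z → ¬ Anc T s z) stays-outside w s∉ par-outside
    where
      par-outside : ¬ Anc T s (par s)
      par-outside s≤ps = parent≢self s≢r (anc-antisym (anc-parent s) s≤ps)
      stays-outside : ∀ {w w′} → TreeAdj T w w′ → w′ ≢ s → ¬ Anc T s w → ¬ Anc T s w′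
      stays-outside (inj₁ (refl , _)) _    s≰w s≤w′ = s≰w (anc-from-parent s≤w′)
      stays-outside (inj₂ (refl , _)) w′≢s s≰w s≤w′ = s≰w (anc-to-parent s≤w′ (≢-sym w′≢s))

  twalk-side : ∀ {X Y s t x q v} → TwoSep X Y s t → TWalk T x t q → Unique q → All (s ≢_) q →
               (X ∖ Y) x → v ∈ q → v ≡ t ⊎ (X ∖ Y) v
  twalk-side S (here _)   _ _ x∈ (here refl) = inj₂ x∈
  twalk-side S (here _)   _ _ x∈ (there ())
  twalk-side S (step _ _) _ _ x∈ (here refl) = inj₂ x∈
  twalk-side {t = t} S (step {v = x′} ta w) (_ ∷ unique) (_ ∷ s∉) x∈ (there v∈) with x′ ≟ᶠ t
  ... | yes refl = inj₁ (closed-twalk w unique v∈)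
  ... | no x′≢t  = twalk-side S w unique s∉
                     (step-side S (spanning _ _ ta) x∈ (≢-sym (All.lookup s∉ (twalk-head∈ w)) , x′≢t)) v∈

  child-strictly-between : ∀ {s t u} → par u ≡ s → u ≢ r → ProperAnc T u t → StrictlyBetween s t u
  child-strictly-between par-u≡s u≢r u<t =
    ((1 , par-u≡s) , λ s≡u → parent≢self u≢r (trans par-u≡s s≡u)) , u<t

  -- A tree path from p₂ to its descendant p₄ cannot start upwards (it could not re-enter the subtree of
  -- p₂); it goes down to a child u strictly between p₂ and p₄, which lies on the side of p₃, and it stays
  -- on that side until it reaches p₄.
  interior-side : ∀ {X Y p₂ p₃ p₄} → TwoSep X Y p₂ p₄ → StrictlyBetween p₂ p₄ p₃ → (Y ∖ X) p₃ →
                  ∀ v → InTInterior T p₂ p₄ v → (Y ∖ X) v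
  interior-side S _ _ _ ((_ , here _   , _ , here refl) , v≢p₂ , _) = ⊥-elim (v≢p₂ refl)
  interior-side S _ _ _ ((_ , here _   , _ , there ())  , _)
  interior-side S _ _ _ ((_ , step _ _ , _ , here refl) , v≢p₂ , _) = ⊥-elim (v≢p₂ refl)
  interior-side {p₄ = p₄} S p₃∈ p₃∈Y v ((_ , step {v = u} ta w , p₂∉ ∷ unique , there v∈) , _ , v≢p₄) with ta
  ... | inj₁ (par-p₂≡u , p₂≢r) =
        ⊥-elim (twalk-from-parent par-p₂≡u p₂≢r w p₂∉ (anc-trans (proj₁ (proj₁ p₃∈)) (proj₁ (proj₂ p₃∈))))
  ... | inj₂ (par-u≡p₂ , u≢r) with u ≟ᶠ p₄
  ...   | yes refl = ⊥-elim (v≢p₄ (closed-twalk w unique v∈))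
  ...   | no u≢p₄  = [ ⊥-elim ∘ v≢p₄ , (λ v∈Y → v∈Y) ]′ (twalk-side (flip-sides S) w unique p₂∉ u∈Y v∈)
    where
      u∈Y = walk-side (flip-sides S)
              (interval-walk p₃∈ (child-strictly-between par-u≡p₂ u≢r (twalk-from-child par-u≡p₂ w p₂∉ , u≢p₄)))
              p₃∈Y

  root-side : ∀ {X Y p₁ p₂ p₄} → TwoSep X Y p₂ p₄ → ProperAnc T p₁ p₂ → Anc T p₂ p₄ → (X ∖ Y) p₁ → (X ∖ Y) r
  root-side S (p₁≤p₂ , p₁≢p₂) p₂≤p₄ p₁∈ = walk-side S (root-walk avoids) p₁∈
    where
      avoids : ∀ w → Anc T w _ → Avoids _ _ w
      avoids w w≤p₁ = (λ { refl → p₁≢p₂ (anc-antisym p₁≤p₂ w≤p₁) }) ,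
                      (λ { refl → p₁≢p₂ (anc-antisym p₁≤p₂ (anc-trans p₂≤p₄ w≤p₁)) })

  type2-from-chain : ∀ {X Y p₁ p₂ p₃ p₄} → TwoSep X Y p₂ p₄ → ProperAnc T p₁ p₂ → StrictlyBetween p₂ p₄ p₃ →
                     Opposite X Y p₁ p₃ → IsType2 G T X Y
  type2-from-chain {X} {Y} {p₁} {p₂} {p₃} {p₄} S p₁<p₂ p₃∈ opp =
    is2-separation S , p₂ , p₄ , separator S , r≢p₂ , r≢p₄ , interior-witness r≢p₂ p₃∈ , sides opp
    where
      p₂≤p₄ = anc-trans (proj₁ (proj₁ p₃∈)) (proj₁ (proj₂ p₃∈))
      r≢p₂ = ≢-sym (properAnc⇒≢root p₁<p₂)
      r≢p₄ = ≢-sym (properAnc⇒≢root (p₂≤p₄ , s≢t S))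
      sides : Opposite X Y p₁ p₃ → Type2Side T X Y p₂ p₄ ⊎ Type2Side T Y X p₂ p₄
      sides (inj₁ (p₁∈ , p₃∈Y)) = inj₁ (root-side S p₁<p₂ p₂≤p₄ p₁∈ , interior-side S p₃∈ p₃∈Y)
      sides (inj₂ (p₁∈ , p₃∈X)) = inj₂ (root-side (flip-sides S) p₁<p₂ p₂≤p₄ p₁∈ , interior-side (flip-sides S) p₃∈ p₃∈X)

  -- A separator vertex x of (C, D) lies between a and b, and one y of (A, B) between c and d. If x = c and
  -- y = b, the chain a < c < b < d makes (C, D) type-2; if x = d and y = a, the chain c < a < d < b makes
  -- (A, B) type-2; the other two cases force c = a or d = b.
  ordered-crossing-type2 : ∀ {A B C D a b c d} → TwoSep A B a b → TwoSep C D c d →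
                           Opposite C D a b → Opposite A B c d → Anc T a b → Anc T c d →
                           IsType2 G T A B ⊎ IsType2 G T C D
  ordered-crossing-type2 SAB SCD ab-opp cd-opp a≤b c≤d
    with opposite-avoids SAB cd-opp | separator-between SCD ab-opp a≤b | separator-between SAB cd-opp c≤d
  ... | (c≢a , c≢b) , (d≢a , d≢b) | _ , (a≤x , x≤b) , inj₁ refl | _ , (c≤y , y≤d) , inj₁ refl =
        ⊥-elim (c≢a (anc-antisym c≤y a≤x))
  ... | (c≢a , c≢b) , (d≢a , d≢b) | _ , (a≤x , x≤b) , inj₁ refl | _ , (c≤y , y≤d) , inj₂ refl =
        inj₂ (type2-from-chain SCD (a≤x , ≢-sym c≢a) ((x≤b , c≢b) , (y≤d , ≢-sym d≢b)) ab-opp)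
  ... | (c≢a , c≢b) , (d≢a , d≢b) | _ , (a≤x , x≤b) , inj₂ refl | _ , (c≤y , y≤d) , inj₁ refl =
        inj₁ (type2-from-chain SAB (c≤y , c≢a) ((a≤x , ≢-sym d≢a) , (x≤b , d≢b)) cd-opp)
  ... | (c≢a , c≢b) , (d≢a , d≢b) | _ , (a≤x , x≤b) , inj₂ refl | _ , (c≤y , y≤d) , inj₂ refl =
        ⊥-elim (d≢b (anc-antisym x≤b y≤d))

  crossing-type2 : ∀ {A B C D a b c d} → TwoSep A B a b → TwoSep C D c d → (A ∖ B) c → (B ∖ A) d →
                   IsType2 G T A B ⊎ IsType2 G T C D
  crossing-type2 {C = C} {D} SAB SCD c∈ d∈
    with crossing⇒opposite SAB SCD c∈ d∈ | separator-comparable SAB | separator-comparable SCD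
  ... | ab-opp | inj₁ a≤b | inj₁ c≤d = ordered-crossing-type2 SAB SCD ab-opp (inj₁ (c∈ , d∈)) a≤b c≤d
  ... | ab-opp | inj₂ b≤a | inj₁ c≤d =
        ordered-crossing-type2 (flip-separator SAB) SCD (opposite-swap {X = C} {D} ab-opp) (inj₁ (c∈ , d∈)) b≤a c≤d
  ... | ab-opp | inj₁ a≤b | inj₂ d≤c =
        ordered-crossing-type2 SAB (flip-separator SCD) ab-opp (inj₂ (d∈ , c∈)) a≤b d≤c
  ... | ab-opp | inj₂ b≤a | inj₂ d≤c =
        ordered-crossing-type2 (flip-separator SAB) (flip-separator SCD) (opposite-swap {X = C} {D} ab-opp) (inj₂ (d∈ , c∈)) b≤a d≤c

  type1-nested : ∀ {A B C D a b c d} → TwoSep A B a b → TwoSep C D c d → HalfConnected G A B →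
                 ¬ IsType2 G T A B → ¬ IsType2 G T C D → Nested A B C D
  type1-nested {c = c} {d} SAB SCD half ¬AB ¬CD with same-side-or-crossing SAB c d
  ... | inj₁ (Ac , Ad)               = nested-if-separator-in-side SAB SCD half Ac Ad
  ... | inj₂ (inj₁ (Bc , Bd))        =
        nested-swapˡ (nested-if-separator-in-side (flip-sides SAB) SCD (Sum.swap half) Bc Bd)
  ... | inj₂ (inj₂ (inj₁ (c∈ , d∈))) = ⊥-elim ([ ¬AB , ¬CD ]′ (crossing-type2 SAB SCD c∈ d∈))
  ... | inj₂ (inj₂ (inj₂ (c∈ , d∈))) = ⊥-elim ([ ¬AB , ¬CD ]′ (crossing-type2 SAB (flip-separator SCD) d∈ c∈))

lemma5p1 : (n : ℕ) (G : Graph n) (T : RootedTree n) →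
    TwoConnected G → Spanning G T → Normal G T → Compatible G T →
    (A B A′ B′ : Vset n) →
    HalfConnected G A B → IsType1 G T A B → IsType1 G T A′ B′ →
    Nested A B A′ B′
lemma5p1 n G T two-connected spanning normal compatible A B A′ B′ half (AB , ¬AB-type2) (A′B′ , ¬A′B′-type2) =
  type1-nested (two-sep AB) (two-sep A′B′) half ¬AB-type2 ¬A′B′-type2
  where
    open Separations G
    open NormalTreeSeparations G T spanning normal (proj₂ (proj₂ two-connected)) (anc-dec {G = G} {T} compatible)
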